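{- Let $k \ge 1$, $a_1,\dots,a_k, c \in \mathbb{Z}$, and let $\mathcal{P}_{\mathrm{thr}}$ be the threshold protocol for $\sum_{i=1}^k a_i x_i < c$ (defined in the context). Let $C, C'$ be terminal configurations of $\mathcal{P}_{\mathrm{thr}}$ each of which contains a leader. Then both $C$ and $C'$ are consensus configurations. Moreover, if $\mathrm{val}(C) = \mathrm{val}(C')$, then $O(C) = O(C')$.
   Context: Threshold protocol: $v_{\max} = \max(|a_1|, \dots, |a_k|, |c|+1)$, $f(m,n) = \max(-v_{\max}, \min(v_{\max}, m+n))$, $g(m,n) = (m+n) - f(m,n)$, $b(m,n) = 1$ if $f(m,n) < c$ else $0$. $\mathcal{P}_{\mathrm{thr}} = (Q,T,\Sigma,I,O)$ with $Q = \{0,1\} \times \{ -v_{\max},\dots,v_{\max}\} \times \{0,1\}$, $\Sigma = \{x_1,\dots,x_k\}$, $I(x_i) = (1, a_i, [a_i < c])$ ($[\cdot]\in\{0,1\}$ the truth value), $O(\ell,n,o) = o$, and $T$ contains for all $n,n' \in \{ -v_{\max},\dots,v_{\max}\}$ and $\ell,o,o' \in \{0,1\}$ the transition $(1,n,o),(\ell,n',o') \mapsto (1,f(n,n'),b(n,n')),(0,g(n,n'),b(n,n'))$, together with silent transitions $(p,q)\mapsto(p,q)$ for pairs of states both with first component $0$. A state $(\ell,n,o)$ is a leader if $\ell = 1$; a configuration contains a leader if some leader is in its support. $\mathrm{val}(\ell,n,o) = n$ and $\mathrm{val}(C) = \sum_{q} C(q)\,\mathrm{val}(q)$. Configurations are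 maps $C : Q \to \mathbb{N}$ with $\sum_q C(q) \ge 2$. A transition $(p,q)\mapsto(p',q')$ is enabled at $C$ if $C$ contains the multiset $\{p,q\}$, and leads to $C - \{p,q\} + \{p',q'\}$. $C$ is terminal if every configuration reachable from $C$ equals $C$; $C$ is a consensus configuration if all states in its support have the same output, denoted $O(C)$. -}

module Defs where

open import Data.Nat as ℕ using (ℕ; zero; suc; _≤_; _<_; s≤s)
open import Data.Nat.Properties using (m⊓n≤n)
open import Data.Integer as ℤ using (ℤ; +_; ∣_∣)
open import Data.Fin using (Fin; toℕ; fromℕ<)
open import Data.Fin.Properties renaming (_≟_ to _≟ᶠ_)
open import Data.Bool using (Bool; true; false; if_then_else_)
open import Data.Bool.Properties renaming (_≟_ to _≟ᵇ_)
open import Data.Product using (Σ; ∃; _×_; _,_; proj₁; proj₂)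
open import Data.Product.Properties using (≡-dec)
open import Data.List using (List; []; _∷_; concatMap; map; foldr)
open import Data.Nat.ListAction using (sum)
open import Data.List as L using (allFin)
open import Relation.Nullary using (Dec; yes; no; does)
open import Relation.Nullary.Decidable using (⌊_⌋)
open import Relation.Binary.PropositionalEquality using (_≡_)
open import Relation.Binary.Definitions using (DecidableEquality)
open import Relation.Binary.Construct.Closure.ReflexiveTransitive using (Star)

module Threshold (k : ℕ) (a : Fin k → ℤ) (c : ℤ) where

  maxAbs : (m : ℕ) → (Fin m → ℤ) → ℕ → ℕ
  maxAbs zero    f acc = acc
  maxAbs (suc m) f acc = ∣ f Fin.zero ∣ ℕ.⊔ maxAbs m (λ i → f (Fin.suc i)) acc

  vmax : ℕ
  vmax = maxAbs k a (suc ∣ c ∣)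

  -- The number component {-v_max, ..., v_max}, encoded as Fin (2 v_max + 1):
  -- index i represents the integer i - v_max.
  Num : Set
  Num = Fin (suc (2 ℕ.* vmax))

  toℤ : Num → ℤ
  toℤ i = (+ toℕ i) ℤ.- (+ vmax)

  clamp : ℤ → ℤ
  clamp z = (ℤ.- (+ vmax)) ℤ.⊔ (z ℤ.⊓ (+ vmax))

  -- the element of Num representing clamp z (identity on values already in range)
  fromℤ : ℤ → Num
  fromℤ z = fromℕ< {m = ∣ clamp z ℤ.+ (+ vmax) ∣ ℕ.⊓ (2 ℕ.* vmax)}
                   (s≤s (m⊓n≤n _ _))

  f : ℤ → ℤ → ℤ
  f m n = clamp (m ℤ.+ n)

  g : ℤ → ℤ → ℤ
  g m n = (m ℤ.+ n) ℤ.- f m n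

  b : ℤ → ℤ → Bool
  b m n = ⌊ f m n ℤ.<? c ⌋

  -- States Q = {0,1} × {-v_max..v_max} × {0,1}; Bool true encodes 1.
  Q : Set
  Q = Bool × Num × Bool

  leader : Q → Bool
  leader (ℓ , _ , _) = ℓ

  num : Q → ℤ
  num (_ , n , _) = toℤ n

  O : Q → Bool
  O (_ , _ , o) = o

  I : Fin k → Q
  I i = (true , fromℤ (a i) , ⌊ a i ℤ.<? c ⌋)

  _≟Q_ : DecidableEquality Q
  _≟Q_ = ≡-dec _≟ᵇ_ (≡-dec _≟ᶠ_ _≟ᵇ_)

  data Trans : Q → Q → Q → Q → Set where
    active : ∀ (n n' : Num) (ℓ o o' : Bool) →
      Trans (true , n , o) (ℓ , n' , o')
            (true  , fromℤ (f (toℤ n) (toℤ n')) , b (toℤ n) (toℤ n'))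
            (false , fromℤ (g (toℤ n) (toℤ n')) , b (toℤ n) (toℤ n'))
    silent : ∀ (p q : Q) → leader p ≡ false → leader q ≡ false → Trans p q p q

  bools : List Bool
  bools = true ∷ false ∷ []

  allQ : List Q
  allQ = concatMap (λ ℓ → concatMap (λ n → map (λ o → (ℓ , n , o)) bools) (allFin _)) bools

  -- Configurations: maps Q → ℕ (size ≥ 2 imposed separately)
  Config : Set
  Config = Q → ℕ

  size : Config → ℕ
  size C = sum (map C allQ)

  val : Config → ℤ
  val C = foldr (λ q acc → (+ C q) ℤ.* num q ℤ.+ acc) (+ 0) allQ

  pair : Q → Q → Config
  pair p q x = (if does (x ≟Q p) then 1 else 0) ℕ.+ (if does (x ≟Q q) then 1 else 0)

  -- C ⟶ D : some transition (p,q) ↦ (p',q') is enabled at C (C ⊇ {p,q}) and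
  -- D = C - {p,q} + {p',q'}  (stated without truncated subtraction)
  data Step (C D : Config) : Set where
    step : ∀ p q p' q' → Trans p q p' q' →
           (∀ x → pair p q x ≤ C x) →
           (∀ x → D x ℕ.+ pair p q x ≡ C x ℕ.+ pair p' q' x) →
           Step C D

  Reachable : Config → Config → Set
  Reachable = Star Step

  Terminal : Config → Set
  Terminal C = ∀ D → Reachable C D → ∀ x → D x ≡ C x

  ContainsLeader : Config → Set
  ContainsLeader C = Σ Q λ q → leader q ≡ true × 0 < C q

  -- all states in the support have output o  (then O(C) = o)
  ConsensusWith : Config → Bool → Set
  ConsensusWith C o = ∀ q → 0 < C q → O q ≡ o

  IsConsensus : Config → Set
  IsConsensus C = ∃ λ o → ConsensusWith C o

module Submission where

-- In a terminal configuration, letting the leader (true, n, o) meet any other agent q must give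
-- back {leader, q}.  The active transition always produces one leader and one non-leader, so q is
-- a non-leader with output o (consensus), the leader occurs exactly once, and clamp (n + val q) = n.
-- The last equation says val q ≥ 0 if n = v_max, val q ≤ 0 if n = -v_max, and val q = 0 otherwise;
-- these sign conditions survive summation, so val C = n + R with R of the same kind, and since
-- |c| < v_max, n < c holds iff val C < c.  The leader's output is [n < c] (read off any interaction
-- with a second agent, which exists as C has size ≥ 2), hence it is determined by val C.

open import Defs
open import Algebra.Bundles using (CommutativeMonoid)
open import Data.Bool using (Bool; true; false)
open import Data.Empty using (⊥-elim)
open import Data.Fin using (Fin)
open import Data.Fin.Properties using (toℕ-fromℕ<)
open import Data.Integer as ℤ using (ℤ; +_; -[1+_]; 0ℤ; ∣_∣; -_; _⊔_; _⊓_; +<+; -<+; -<-)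
import Data.Integer.Properties as ℤP
open import Algebra.Properties.AbelianGroup ℤP.+-0-abelianGroup using (identityʳ-unique)
open import Data.List using (List; []; _∷_; _++_; map; concatMap; foldr; allFin)
open import Data.List.Properties using (foldr-map; foldr-preservesᵇ)
open import Data.List.Membership.Propositional using (_∈_; find)
open import Data.List.Membership.Propositional.Properties using (∈-map⁺; ∈-concatMap⁺; ∈-allFin; ∈-∃++)
open import Data.List.Relation.Binary.Disjoint.Propositional using (Disjoint)
open import Data.List.Relation.Binary.Permutation.Propositional using (_↭_; ↭⇒↭ₛ)
import Data.List.Relation.Binary.Permutation.Propositional.Properties as ↭
open import Data.List.Relation.Binary.Permutation.Setoid.Properties using (foldr-commMonoid; Unique-resp-↭)
open import Data.List.Relation.Unary.All as All using (All; []; _∷_)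
import Data.List.Relation.Unary.All.Properties as All
open import Data.List.Relation.Unary.AllPairs as AllPairs using ([]; _∷_)
import Data.List.Relation.Unary.AllPairs.Properties as AllPairs
open import Data.List.Relation.Unary.Any as Any using (Any; here; there)
import Data.List.Relation.Unary.Any.Properties as Any
open import Data.List.Relation.Unary.Unique.Propositional using (Unique)
import Data.List.Relation.Unary.Unique.Propositional.Properties as Unique
open import Data.Nat as ℕ using (ℕ)
import Data.Nat.Properties as ℕP
open import Data.Nat.ListAction using (sum)
open import Data.Nat.ListAction.Properties using (sum-↭)
open import Data.Product using (∃; _×_; _,_; proj₁; proj₂)
open import Data.Sum using (_⊎_; inj₁; inj₂)
open import Function using (_∘_; _⇔_; mk⇔)
open import Relation.Binary.Construct.Closure.ReflexiveTransitive using (ε; _◅_)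
open import Relation.Binary.Core using (_Preserves_⟶_)
open import Relation.Binary.Definitions using (tri<; tri≈; tri>)
open import Relation.Binary.PropositionalEquality
  using (_≡_; _≢_; refl; sym; trans; cong; cong₂; subst; setoid; module ≡-Reasoning)
open import Relation.Nullary using (Dec; yes; no; contradiction)
open import Relation.Nullary.Decidable using (⌊_⌋; isYes≗does; does-⇔)

∣i∣<n⇒-n<i<n : ∀ {n} i → ∣ i ∣ ℕ.< n → - + n ℤ.< i × i ℤ.< + n
∣i∣<n⇒-n<i<n {ℕ.suc n} (+ m)    m<n         = -<+ , +<+ m<n
∣i∣<n⇒-n<i<n {ℕ.suc n} -[1+ m ] (ℕ.s≤s m<n) = -<- m<n , -<+

module Saturation (V : ℕ) where

  open import Data.Integer using (_+_; _*_; _≤_; _<_)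

  clamp : ℤ → ℤ
  clamp z = - + V ⊔ (z ⊓ + V)

  clamp-lower : ∀ z → - + V ≤ clamp z
  clamp-lower z = ℤP.i≤i⊔j (- + V) (z ⊓ + V)

  clamp-upper : ∀ z → clamp z ≤ + V
  clamp-upper z = ℤP.⊔-lub ℤP.neg-≤-pos (ℤP.i⊓j≤j z (+ V))

  clamp-inside : ∀ {z} → - + V ≤ z → z ≤ + V → clamp z ≡ z
  clamp-inside -V≤z z≤V rewrite ℤP.i≤j⇒i⊓j≡i z≤V = ℤP.i≤j⇒i⊔j≡j -V≤z

  clamp-above : ∀ {z} → + V ≤ z → clamp z ≡ + V
  clamp-above V≤z rewrite ℤP.i≥j⇒i⊓j≡j V≤z = ℤP.i≤j⇒i⊔j≡j ℤP.neg-≤-pos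

  clamp-below : ∀ {z} → z ≤ - + V → clamp z ≡ - + V
  clamp-below z≤-V rewrite ℤP.i≤j⇒i⊓j≡i (ℤP.≤-trans z≤-V (ℤP.neg-≤-pos {n = V})) = ℤP.i≥j⇒i⊔j≡i z≤-V

  clamp-idem : ∀ z → clamp (clamp z) ≡ clamp z
  clamp-idem z = clamp-inside (clamp-lower z) (clamp-upper z)

  clamp-fixed⇒≤ : ∀ {x y} → clamp (x + y) ≡ x → - + V ≤ x × x ≤ + V
  clamp-fixed⇒≤ {x} {y} fixed =
    subst (- + V ≤_) fixed (clamp-lower (x + y)) , subst (_≤ + V) fixed (clamp-upper (x + y))

  clamp-fixed-pos : ∀ {x y} → clamp (x + y) ≡ x → 0ℤ < y → x ≡ + V
  clamp-fixed-pos {x} {y} fixed 0<y with x + y ℤP.≤? + V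
  ... | no  x+y≰V = trans (sym fixed) (clamp-above (ℤP.<⇒≤ (ℤP.≰⇒> x+y≰V)))
  ... | yes x+y≤V = contradiction (sym (identityʳ-unique x y x+y≡x)) (ℤP.<⇒≢ 0<y)
    where
      x≤x+y : x ≤ x + y
      x≤x+y = ℤP.i≤i+j x y {{ℤ.nonNegative (ℤP.<⇒≤ 0<y)}}
      x+y≡x : x + y ≡ x
      x+y≡x = trans (sym (clamp-inside (ℤP.≤-trans (proj₁ (clamp-fixed⇒≤ fixed)) x≤x+y) x+y≤V)) fixed

  clamp-fixed-neg : ∀ {x y} → clamp (x + y) ≡ x → y < 0ℤ → x ≡ - + V
  clamp-fixed-neg {x} {y} fixed y<0 with - + V ℤP.≤? x + y
  ... | no  -V≰x+y = trans (sym fixed) (clamp-below (ℤP.<⇒≤ (ℤP.≰⇒> -V≰x+y)))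
  ... | yes -V≤x+y = contradiction (identityʳ-unique x y x+y≡x) (ℤP.<⇒≢ y<0)
    where
      x+y≤x : x + y ≤ x
      x+y≤x = ℤP.≤-trans (ℤP.+-monoʳ-≤ x (ℤP.<⇒≤ y<0)) (ℤP.≤-reflexive (ℤP.+-identityʳ x))
      x+y≡x : x + y ≡ x
      x+y≡x = trans (sym (clamp-inside -V≤x+y (ℤP.≤-trans x+y≤x (proj₂ (clamp-fixed⇒≤ fixed))))) fixed

  -- For V ≥ 1 and x ∈ [-V, V] this is equivalent to clamp (x + y) ≡ x; unlike that equation it is
  -- closed under sums.
  record Absorbed (x y : ℤ) : Set where
    field
      at-top    : x ≡ + V → 0ℤ ≤ y
      at-bottom : x ≡ - + V → y ≤ 0ℤ
      inside    : x ≢ + V → x ≢ - + V → y ≡ 0ℤ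

  absorbed-0 : ∀ {x} → Absorbed x 0ℤ
  absorbed-0 = record { at-top = λ _ → ℤP.≤-refl ; at-bottom = λ _ → ℤP.≤-refl ; inside = λ _ _ → refl }

  absorbed-+ : ∀ {x y z} → Absorbed x y → Absorbed x z → Absorbed x (y + z)
  absorbed-+ y′ z′ = record
    { at-top    = λ x≡V → ℤP.+-mono-≤ (at-top y′ x≡V) (at-top z′ x≡V)
    ; at-bottom = λ x≡-V → ℤP.+-mono-≤ (at-bottom y′ x≡-V) (at-bottom z′ x≡-V)
    ; inside    = λ x≢V x≢-V → cong₂ _+_ (inside y′ x≢V x≢-V) (inside z′ x≢V x≢-V)
    }
    where open Absorbed

  absorbed-*ℕ : ∀ {x y m} → (0 ℕ.< m → Absorbed x y) → Absorbed x (+ m * y)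
  absorbed-*ℕ {m = ℕ.zero}  _    = absorbed-0
  absorbed-*ℕ {y = y} {m = ℕ.suc m} y′ = record
    { at-top    = λ x≡V → subst (_≤ + ℕ.suc m * y) (ℤP.*-zeroʳ (+ ℕ.suc m))
                            (ℤP.*-monoˡ-≤-nonNeg (+ ℕ.suc m) (at-top (y′ ℕ.z<s) x≡V))
    ; at-bottom = λ x≡-V → subst (+ ℕ.suc m * y ≤_) (ℤP.*-zeroʳ (+ ℕ.suc m))
                            (ℤP.*-monoˡ-≤-nonNeg (+ ℕ.suc m) (at-bottom (y′ ℕ.z<s) x≡-V))
    ; inside    = λ x≢V x≢-V → trans (cong (+ ℕ.suc m *_) (inside (y′ ℕ.z<s) x≢V x≢-V))
                                     (ℤP.*-zeroʳ (+ ℕ.suc m))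
    }
    where open Absorbed

  module _ {{_ : ℕ.NonZero V}} where

    +V≢-V : + V ≢ - + V
    +V≢-V V≡-V = ℤP.<⇒≢ (ℤP.<-trans (ℤP.neg-mono-< 0<V) 0<V) (sym V≡-V)
      where
        0<V : 0ℤ < + V
        0<V = +<+ (ℕ.>-nonZero⁻¹ V)

    clamp-fixed⇒absorbed : ∀ {x y} → clamp (x + y) ≡ x → Absorbed x y
    clamp-fixed⇒absorbed {x} {y} fixed = record
      { at-top    = λ x≡V → ℤP.≮⇒≥ λ y<0 → +V≢-V (trans (sym x≡V) (clamp-fixed-neg fixed y<0))
      ; at-bottom = λ x≡-V → ℤP.≮⇒≥ λ 0<y → +V≢-V (trans (sym (clamp-fixed-pos fixed 0<y)) x≡-V)
      ; inside    = inside
      }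
      where
        inside : x ≢ + V → x ≢ - + V → y ≡ 0ℤ
        inside x≢V x≢-V with ℤP.<-cmp y 0ℤ
        ... | tri< y<0 _ _ = contradiction (clamp-fixed-neg fixed y<0) x≢-V
        ... | tri≈ _ y≡0 _ = y≡0
        ... | tri> _ _ 0<y = contradiction (clamp-fixed-pos fixed 0<y) x≢V

  absorbed-<-invariant : ∀ {c x y} → ∣ c ∣ ℕ.< V → Absorbed x y → (x < c ⇔ x + y < c)
  absorbed-<-invariant {c} {x} {y} ∣c∣<V y′ with ∣i∣<n⇒-n<i<n c ∣c∣<V | x ℤP.≟ + V | x ℤP.≟ - + V
  ... | _ , c<V | yes x≡V | _ = mk⇔
    (λ x<c → ⊥-elim (ℤP.<-asym x<c (subst (c <_) (sym x≡V) c<V)))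
    (λ x+y<c → ⊥-elim (ℤP.<-asym (ℤP.≤-<-trans x≤x+y x+y<c) (subst (c <_) (sym x≡V) c<V)))
    where
      x≤x+y : x ≤ x + y
      x≤x+y = ℤP.i≤i+j x y {{ℤ.nonNegative (Absorbed.at-top y′ x≡V)}}
  ... | -V<c , _ | no _ | yes x≡-V = mk⇔
    (λ _ → ℤP.≤-<-trans (ℤP.≤-trans x+y≤x (ℤP.≤-reflexive x≡-V)) -V<c)
    (λ _ → subst (_< c) (sym x≡-V) -V<c)
    where
      x+y≤x : x + y ≤ x
      x+y≤x = ℤP.≤-trans (ℤP.+-monoʳ-≤ x (Absorbed.at-bottom y′ x≡-V)) (ℤP.≤-reflexive (ℤP.+-identityʳ x))
  ... | _ | no x≢V | no x≢-V = mk⇔ (subst (_< c) (sym x+y≡x)) (subst (_< c) x+y≡x)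
    where
      x+y≡x : x + y ≡ x
      x+y≡x = trans (cong (λ t → x + t) (Absorbed.inside y′ x≢V x≢-V)) (ℤP.+-identityʳ x)

  -- Inverse of the encoding of [-V, V] into Fin (2V + 1) used by the protocol.
  shift-inverse : ∀ {w} → - + V ≤ w → w ≤ + V → + (∣ w + + V ∣ ℕ.⊓ (2 ℕ.* V)) ℤ.- + V ≡ w
  shift-inverse {w} -V≤w w≤V = begin
    + (∣ w + + V ∣ ℕ.⊓ (2 ℕ.* V)) ℤ.- + V ≡⟨ cong (λ m → + m ℤ.- + V) (ℕP.m≤n⇒m⊓n≡m ∣w+V∣≤2V) ⟩
    + ∣ w + + V ∣ ℤ.- + V                 ≡⟨ cong (ℤ._- + V) (ℤP.0≤i⇒+∣i∣≡i 0≤w+V) ⟩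
    w + + V ℤ.- + V                       ≡⟨ ℤP.+-assoc w (+ V) (- + V) ⟩
    w + (+ V ℤ.- + V)                     ≡⟨ cong (λ t → w + t) (ℤP.+-inverseʳ (+ V)) ⟩
    w + 0ℤ                                ≡⟨ ℤP.+-identityʳ w ⟩
    w                                     ∎
    where
      open ≡-Reasoning
      0≤w+V : 0ℤ ≤ w + + V
      0≤w+V = subst (_≤ w + + V) (ℤP.+-inverseˡ (+ V)) (ℤP.+-monoˡ-≤ (+ V) -V≤w)
      w+V≤2V : w + + V ≤ + (2 ℕ.* V)
      w+V≤2V = subst (λ m → w + + V ≤ + (V ℕ.+ m)) (sym (ℕP.+-identityʳ V)) (ℤP.+-monoˡ-≤ (+ V) w≤V)
      ∣w+V∣≤2V : ∣ w + + V ∣ ℕ.≤ 2 ℕ.* V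
      ∣w+V∣≤2V = ℤP.drop‿+≤+ (subst (_≤ + (2 ℕ.* V)) (sym (ℤP.0≤i⇒+∣i∣≡i 0≤w+V)) w+V≤2V)

⌊⌋-⇔ : ∀ {A B : Set} {a? : Dec A} {b? : Dec B} → A ⇔ B → ⌊ a? ⌋ ≡ ⌊ b? ⌋
⌊⌋-⇔ {a? = a?} {b?} A⇔B = trans (isYes≗does a?) (trans (does-⇔ A⇔B a? b?) (sym (isYes≗does b?)))

sum-positive⇒Any-positive : ∀ ns → 0 ℕ.< sum ns → Any (0 ℕ.<_) ns
sum-positive⇒Any-positive (ℕ.zero ∷ ns) 0<sum = there (sum-positive⇒Any-positive ns 0<sum)
sum-positive⇒Any-positive (ℕ.suc n ∷ ns) _   = here ℕ.z<s

sumℤ : List ℤ → ℤ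
sumℤ = foldr ℤ._+_ 0ℤ

sumℤ-↭ : sumℤ Preserves _↭_ ⟶ _≡_
sumℤ-↭ p = foldr-commMonoid ℤ+.setoid ℤ+.isCommutativeMonoid (↭⇒↭ₛ p)
  where module ℤ+ = CommutativeMonoid ℤP.+-0-commutativeMonoid

Unique-concatMap⁺ : ∀ {A B : Set} {f : A → List B} {xs} (π : B → A) →
  (∀ x → All (λ y → π y ≡ x) (f x)) → (∀ x → Unique (f x)) → Unique xs → Unique (concatMap f xs)
Unique-concatMap⁺ {f = f} {xs} π tagged unique-f unique-xs =
  Unique.concat⁺ (All.map⁺ (All.universal unique-f xs)) (AllPairs.map⁺ (AllPairs.map disjoint unique-xs))
  where
    disjoint : ∀ {x x′} → x ≢ x′ → Disjoint (f x) (f x′)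
    disjoint x≢x′ (y∈fx , y∈fx′) = x≢x′ (trans (sym (All.lookup (tagged _) y∈fx)) (All.lookup (tagged _) y∈fx′))

module ThresholdProperties (k : ℕ) (a : Fin k → ℤ) (c : ℤ) where

  open Threshold k a c hiding (clamp)
  open Saturation vmax

  maxAbs-≥ : ∀ m (h : Fin m → ℤ) acc → acc ℕ.≤ maxAbs m h acc
  maxAbs-≥ ℕ.zero    h acc = ℕP.≤-refl
  maxAbs-≥ (ℕ.suc m) h acc = ℕP.m≤n⇒m≤o⊔n _ (maxAbs-≥ m (h ∘ Fin.suc) acc)

  ∣c∣<vmax : ∣ c ∣ ℕ.< vmax
  ∣c∣<vmax = maxAbs-≥ k a (ℕ.suc ∣ c ∣)

  instance
    vmax-nonZero : ℕ.NonZero vmax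
    vmax-nonZero = ℕ.>-nonZero (ℕP.≤-<-trans ℕ.z≤n ∣c∣<vmax)

  toℤ-fromℤ : ∀ z → toℤ (fromℤ z) ≡ clamp z
  toℤ-fromℤ z rewrite toℕ-fromℕ< {m = ∣ clamp z ℤ.+ + vmax ∣ ℕ.⊓ (2 ℕ.* vmax)} (ℕ.s≤s (ℕP.m⊓n≤n _ _)) =
    shift-inverse (clamp-lower z) (clamp-upper z)

  row : Bool → Num → List Q
  row ℓ n = map (λ o → ℓ , n , o) bools

  layer : Bool → List Q
  layer ℓ = concatMap (row ℓ) (allFin _)

  ∈-bools : ∀ o → o ∈ bools
  ∈-bools true  = here refl
  ∈-bools false = there (here refl)

  ∈-allQ : ∀ q → q ∈ allQ
  ∈-allQ (ℓ , n , o) = ∈-concatMap⁺ layer (Any.map (λ { refl → ∈-layer }) (∈-bools ℓ))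
    where
      ∈-layer : (ℓ , n , o) ∈ layer ℓ
      ∈-layer = ∈-concatMap⁺ (row ℓ)
        (Any.map (λ { refl → ∈-map⁺ (λ o′ → ℓ , n , o′) (∈-bools o) }) (∈-allFin n))

  bools-unique : Unique bools
  bools-unique = ((λ ()) ∷ []) ∷ [] ∷ []

  allQ-unique : Unique allQ
  allQ-unique = Unique-concatMap⁺ {f = layer} proj₁ layer-tagged layer-unique bools-unique
    where
      row-tagged : ∀ ℓ n → All (λ q → proj₁ q ≡ ℓ × proj₁ (proj₂ q) ≡ n) (row ℓ n)
      row-tagged ℓ n = All.map⁺ {f = λ o → ℓ , n , o} (All.universal (λ _ → refl , refl) bools)
      layer-tagged : ∀ ℓ → All (λ q → proj₁ q ≡ ℓ) (layer ℓ)
      layer-tagged ℓ =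
        All.concat⁺ (All.map⁺ {f = row ℓ} (All.universal (λ n → All.map proj₁ (row-tagged ℓ n)) (allFin _)))
      layer-unique : ∀ ℓ → Unique (layer ℓ)
      layer-unique ℓ = Unique-concatMap⁺ {f = row ℓ} (proj₁ ∘ proj₂) (λ n → All.map proj₂ (row-tagged ℓ n))
        (λ n → Unique.map⁺ {f = λ o → ℓ , n , o} (cong (proj₂ ∘ proj₂)) bools-unique) (Unique.allFin⁺ _)

  allQ-pivot : ∀ p → ∃ λ rest → allQ ↭ p ∷ rest × All (p ≢_) rest
  allQ-pivot p with ys , zs , allQ≡ ← ∈-∃++ (∈-allQ p) = ys ++ zs , perm , fresh
    where
      perm : allQ ↭ p ∷ ys ++ zs
      perm = subst (_↭ p ∷ ys ++ zs) (sym allQ≡) (↭.shift p ys zs)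
      fresh : All (p ≢_) (ys ++ zs)
      fresh = AllPairs.head (Unique-resp-↭ (setoid Q) (↭⇒↭ₛ perm) allQ-unique)

  weight : Config → Q → ℤ
  weight C q = + C q ℤ.* num q

  size-pivot : ∀ (C : Config) {p rest} → allQ ↭ p ∷ rest → size C ≡ C p ℕ.+ sum (map C rest)
  size-pivot C perm = sum-↭ (↭.map⁺ C perm)

  val-pivot : ∀ (C : Config) {p rest} → allQ ↭ p ∷ rest → val C ≡ weight C p ℤ.+ sumℤ (map (weight C) rest)
  val-pivot C perm = trans (sym (foldr-map ℤ._+_ (weight C) 0ℤ allQ)) (sumℤ-↭ (↭.map⁺ (weight C) perm))

  pair-posˡ : ∀ p q → 0 ℕ.< pair p q p
  pair-posˡ p q with p ≟Q p
  ... | yes _   = ℕ.z<s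
  ... | no p≢p = contradiction refl p≢p

  pair-posʳ : ∀ p q → 0 ℕ.< pair p q q
  pair-posʳ p q with q ≟Q q
  ... | yes _   = ℕP.≤-trans ℕ.z<s (ℕP.m≤n+m 1 _)
  ... | no q≢q = contradiction refl q≢q

  pair-pos⇒∈ : ∀ {p q x} → 0 ℕ.< pair p q x → x ≡ p ⊎ x ≡ q
  pair-pos⇒∈ {p} {q} {x} 0<pair with x ≟Q p | x ≟Q q
  ... | yes x≡p | _       = inj₁ x≡p
  ... | no _    | yes x≡q = inj₂ x≡q
  ... | no _    | no _    with () ← 0<pair

  pair-≤ : ∀ (C : Config) {p q} → 0 ℕ.< C p → 0 ℕ.< C q → q ≢ p ⊎ 2 ℕ.≤ C p → ∀ x → pair p q x ℕ.≤ C x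
  pair-≤ C {p} {q} 0<p 0<q q≢p⊎2≤p x with x ≟Q p | x ≟Q q
  pair-≤ C 0<p 0<q (inj₁ q≢p) x | yes refl | yes refl = contradiction refl q≢p
  pair-≤ C 0<p 0<q (inj₂ 2≤p) x | yes refl | yes refl = 2≤p
  pair-≤ C 0<p 0<q _          x | yes refl | no _     = 0<p
  pair-≤ C 0<p 0<q _          x | no _     | yes refl = 0<q
  pair-≤ C 0<p 0<q _          x | no _     | no _     = ℕ.z≤n

  terminal-fixes-pair : ∀ {C p q p′ q′} → Terminal C → Trans p q p′ q′ → (∀ x → pair p q x ℕ.≤ C x) →
                        ∀ x → pair p′ q′ x ≡ pair p q x
  terminal-fixes-pair {C} {p} {q} {p′} {q′} T t enabled x =
    ℕP.+-cancelˡ-≡ (C x) _ _ (sym (trans (cong (ℕ._+ pair p q x) (sym (D≡C x))) (D-step x)))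
    where
      D : Config
      D y = (C y ℕ.+ pair p′ q′ y) ℕ.∸ pair p q y
      D-step : ∀ y → D y ℕ.+ pair p q y ≡ C y ℕ.+ pair p′ q′ y
      D-step y = ℕP.m∸n+n≡m (ℕP.≤-trans (enabled y) (ℕP.m≤m+n _ _))
      D≡C : ∀ y → D y ≡ C y
      D≡C = T D (step p q p′ q′ t enabled D-step ◅ ε)

  terminal-outcome-∈ : ∀ {C p q p′ q′} → Terminal C → Trans p q p′ q′ → (∀ x → pair p q x ℕ.≤ C x) →
                       (p′ ≡ p ⊎ p′ ≡ q) × (q′ ≡ p ⊎ q′ ≡ q)
  terminal-outcome-∈ {p′ = p′} {q′} T t enabled =
      pair-pos⇒∈ (subst (0 ℕ.<_) (terminal-fixes-pair T t enabled p′) (pair-posˡ p′ q′))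
    , pair-pos⇒∈ (subst (0 ℕ.<_) (terminal-fixes-pair T t enabled q′) (pair-posʳ p′ q′))

  -- An agent in state q that the leader (true , n , o) can meet without changing the configuration.
  record Inert (n : Num) (o : Bool) (q : Q) : Set where
    field
      follower      : leader q ≡ false
      clamp-fixed   : clamp (toℤ n ℤ.+ num q) ≡ toℤ n
      output        : O q ≡ o
      leader-output : o ≡ ⌊ toℤ n ℤ.<? c ⌋

  module _ {C : Config} {n : Num} {o : Bool} (T : Terminal C) (0<L : 0 ℕ.< C (true , n , o)) where

    terminal⇒inert : ∀ {q} → 0 ℕ.< C q → q ≢ (true , n , o) ⊎ 2 ℕ.≤ C (true , n , o) → Inert n o q
    terminal⇒inert {ℓ , m , o′} 0<q distinct
      with terminal-outcome-∈ T (active n m ℓ o o′) (pair-≤ C 0<L 0<q distinct)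
    ... | _ , inj₁ q″≡L = contradiction (cong proj₁ q″≡L) λ ()
    ... | inj₂ p′≡q , inj₂ q″≡q = contradiction (trans (cong proj₁ p′≡q) (sym (cong proj₁ q″≡q))) λ ()
    ... | inj₁ p′≡L , inj₂ q″≡q = record
      { follower      = sym (cong proj₁ q″≡q)
      ; clamp-fixed   = clamp-fixed
      ; output        = trans (sym (cong (proj₂ ∘ proj₂) q″≡q)) (cong (proj₂ ∘ proj₂) p′≡L)
      ; leader-output = trans (sym (cong (proj₂ ∘ proj₂) p′≡L)) (cong (λ z → ⌊ z ℤ.<? c ⌋) clamp-fixed)
      }
      where
        open ≡-Reasoning
        clamp-fixed : clamp (toℤ n ℤ.+ toℤ m) ≡ toℤ n
        clamp-fixed = begin
          clamp (toℤ n ℤ.+ toℤ m)          ≡⟨ clamp-idem _ ⟨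
          clamp (f (toℤ n) (toℤ m))        ≡⟨ toℤ-fromℤ _ ⟨
          toℤ (fromℤ (f (toℤ n) (toℤ m)))  ≡⟨ cong (toℤ ∘ proj₁ ∘ proj₂) p′≡L ⟩
          toℤ n                            ∎

    inert-other : ∀ {q} → (true , n , o) ≢ q → 0 ℕ.< C q → Inert n o q
    inert-other L≢q 0<q = terminal⇒inert 0<q (inj₁ (L≢q ∘ sym))

    terminal⇒leader-unique : C (true , n , o) ≡ 1
    terminal⇒leader-unique with 2 ℕP.≤? C (true , n , o)
    ... | yes 2≤L = contradiction (Inert.follower (terminal⇒inert 0<L (inj₂ 2≤L))) λ ()
    ... | no 2≰L  = ℕP.≤-antisym (ℕ.s≤s⁻¹ (ℕP.≰⇒> 2≰L)) 0<L

    terminal⇒consensus : ConsensusWith C o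
    terminal⇒consensus q 0<q with (true , n , o) ≟Q q
    ... | yes refl = refl
    ... | no L≢q   = Inert.output (inert-other L≢q 0<q)

    terminal⇒val : ∀ {rest} → allQ ↭ (true , n , o) ∷ rest → val C ≡ toℤ n ℤ.+ sumℤ (map (weight C) rest)
    terminal⇒val perm = trans (val-pivot C perm) (cong (ℤ._+ _) weight-L)
      where
        weight-L : weight C (true , n , o) ≡ toℤ n
        weight-L = trans (cong (λ m → + m ℤ.* toℤ n) terminal⇒leader-unique) (ℤP.*-identityˡ (toℤ n))

    terminal⇒rest-absorbed : ∀ {rest} → All ((true , n , o) ≢_) rest →
                             Absorbed (toℤ n) (sumℤ (map (weight C) rest))
    terminal⇒rest-absorbed fresh =
      foldr-preservesᵇ {P = Absorbed (toℤ n)} absorbed-+ absorbed-0 (All.map⁺ (All.map absorbs fresh))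
      where
        absorbs : ∀ {q} → (true , n , o) ≢ q → Absorbed (toℤ n) (weight C q)
        absorbs L≢q = absorbed-*ℕ λ 0<q → clamp-fixed⇒absorbed (Inert.clamp-fixed (inert-other L≢q 0<q))

    terminal⇒other-agent : ∀ {rest} → 2 ℕ.≤ size C → allQ ↭ (true , n , o) ∷ rest → 0 ℕ.< sum (map C rest)
    terminal⇒other-agent {rest} 2≤size perm = ℕP.+-cancelˡ-≤ 1 1 _
      (subst (2 ℕ.≤_) (trans (size-pivot C perm) (cong (ℕ._+ sum (map C rest)) terminal⇒leader-unique))
             2≤size)

    terminal⇒leader-output : ∀ {rest} → 2 ℕ.≤ size C → allQ ↭ (true , n , o) ∷ rest →
                             All ((true , n , o) ≢_) rest → o ≡ ⌊ toℤ n ℤ.<? c ⌋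
    terminal⇒leader-output {rest} 2≤size perm fresh
      with q , q∈rest , 0<q ← find (Any.map⁻ (sum-positive⇒Any-positive (map C rest)
                                                (terminal⇒other-agent 2≤size perm)))
      = Inert.leader-output (inert-other (All.lookup fresh q∈rest) 0<q)

    terminal⇒output : 2 ℕ.≤ size C → o ≡ ⌊ val C ℤ.<? c ⌋
    terminal⇒output 2≤size with rest , perm , fresh ← allQ-pivot (true , n , o) = begin
      o                      ≡⟨ terminal⇒leader-output 2≤size perm fresh ⟩
      ⌊ toℤ n ℤ.<? c ⌋       ≡⟨ ⌊⌋-⇔ (absorbed-<-invariant ∣c∣<vmax (terminal⇒rest-absorbed fresh)) ⟩
      ⌊ toℤ n ℤ.+ R ℤ.<? c ⌋ ≡⟨ cong (λ z → ⌊ z ℤ.<? c ⌋) (terminal⇒val perm) ⟨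
      ⌊ val C ℤ.<? c ⌋       ∎
      where
        open ≡-Reasoning
        R : ℤ
        R = sumℤ (map (weight C) rest)

open import Data.Nat using (_≤_)

proposition10 : (k : ℕ) → 1 ≤ k → (a : Fin k → ℤ) → (c : ℤ) →
    (C C' : Threshold.Config k a c) →
    2 ≤ Threshold.size k a c C → 2 ≤ Threshold.size k a c C' →
    Threshold.Terminal k a c C → Threshold.Terminal k a c C' →
    Threshold.ContainsLeader k a c C → Threshold.ContainsLeader k a c C' →
    Threshold.IsConsensus k a c C × Threshold.IsConsensus k a c C' ×
    (Threshold.val k a c C ≡ Threshold.val k a c C' →
      ∀ (o o' : Bool) → Threshold.ConsensusWith k a c C o →
        Threshold.ConsensusWith k a c C' o' → o ≡ o')
proposition10 k _ a c C C' 2≤size 2≤size' T T' ((_ , n , o) , refl , 0<L) ((_ , n' , o') , refl , 0<L') =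
    (o , terminal⇒consensus T 0<L)
  , (o' , terminal⇒consensus T' 0<L')
  , λ val≡ o₁ o₂ cons cons' → begin
      o₁                  ≡⟨ cons _ 0<L ⟨
      o                   ≡⟨ terminal⇒output T 0<L 2≤size ⟩
      ⌊ val C ℤ.<? c ⌋    ≡⟨ cong (λ z → ⌊ z ℤ.<? c ⌋) val≡ ⟩
      ⌊ val C' ℤ.<? c ⌋   ≡⟨ terminal⇒output T' 0<L' 2≤size' ⟨
      o'                  ≡⟨ cons' _ 0<L' ⟩
      o₂                  ∎
  where
    open Threshold k a c using (val)
    open ThresholdProperties k a c
    open ≡-Reasoning
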